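{- Let $\Sigma$ be an arbitrary assignment of the labels occupied/unoccupied to the leaves of $T_{\mathrm{saw}}(\mathbb{Z}^2)$, and let $T_{\mathrm{saw}}^\Sigma(\mathbb{Z}^2)$ be the tree obtained from $T_{\mathrm{saw}}(\mathbb{Z}^2)$ by deleting the unoccupied leaves and, for each occupied leaf, deleting that leaf's parent together with the whole subtree rooted at the parent. Then $T_{\boldsymbol{D}_G}$ is a subtree of $T_{\mathrm{saw}}^\Sigma(\mathbb{Z}^2)$, i.e., every walk that is a vertex of $T_{\boldsymbol{D}_G}$ is a vertex of $T_{\mathrm{saw}}^\Sigma(\mathbb{Z}^2)$.
   Context: Steps in $\mathbb{Z}^2$: $N=(0,1),S=(0,-1),E=(1,0),W=(-1,0)$. $T_{\mathrm{saw}}(\mathbb{Z}^2)$ is the rooted tree whose vertices are the walks $(v_0,\dots,v_m)$ with $v_0$ the origin, $v_0,\dots,v_{m-1}$ distinct, $v_m\ne v_{m-2}$, and either $v_m\notin\{v_0,\dots,v_{m-1}\}$ or $v_m=v_i$ for some $i$ (these walks closing a cycle are the leaves); the parent of a walk is the walk with its last step removed. $T_{\boldsymbol{D}_G}$ is the rooted tree of walks from the origin generated by the following state rules, where each state name's last letter is the step just taken and a vertex in a state has one child for each listed state (the child extends the walk by the last letter of its state): $O\to N\,|\,E\,|\,W$ (root), $N\to NN\,|\,NE\,|\,NW$, $W\to WN\,|\,WW$, $E\to EN\,|\,EE$, $NN\to NN\,|\,NE\,|\,NW$, $NW\to WN\,|\,WW$, $NE\to EN\,|\,EE$, $WW\to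 WN\,|\,WW$, $EE\to EN\,|\,EE$, $WN\to NW\,|\,NN$, $EN\to NE\,|\,NN$. Equivalently, its vertices are the walks from the origin with steps in $\{N,E,W\}$ whose step sequence contains none of the consecutive substrings $EW,WE,ENW,WNE$. -}

module Defs where

open import Data.Bool using (Bool; true; false)
open import Data.Integer using (ℤ; +_; _+_; -[1+_])
open import Data.List using (List; []; _∷_; _++_; _∷ʳ_)
open import Data.List.Membership.Propositional using (_∈_)
open import Data.List.Relation.Unary.Unique.Propositional using (Unique)
open import Data.Product using (Σ; Σ-syntax; ∃; ∃-syntax; _×_; _,_)
open import Data.Unit using (⊤)
open import Relation.Binary.PropositionalEquality using (_≡_; _≢_)
open import Relation.Nullary using (¬_)

data Step : Set where
  N S E W : Step

Pt : Set
Pt = ℤ × ℤ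

origin : Pt
origin = (+ 0 , + 0)

move : Pt → Step → Pt
move (x , y) N = (x , y + + 1)
move (x , y) S = (x , y + -[1+ 0 ])
move (x , y) E = (x + + 1 , y)
move (x , y) W = (x + -[1+ 0 ] , y)

endpointFrom : Pt → List Step → Pt
endpointFrom p []       = p
endpointFrom p (s ∷ ss) = endpointFrom (move p s) ss

endpoint : List Step → Pt
endpoint = endpointFrom origin

vertsFrom : Pt → List Step → List Pt
vertsFrom p []       = p ∷ []
vertsFrom p (s ∷ ss) = p ∷ vertsFrom (move p s) ss

-- verts w = (v₀ , v₁ , … , v_m) for a walk w with m steps, v₀ = origin.
verts : List Step → List Pt
verts = vertsFrom origin

-- w = (v₀,…,v_m) is a vertex of T_saw iff v₀,…,v_{m-1} are distinct and
-- v_m ≠ v_{m-2}.  (The "either v_m new or v_m = v_i" clause is exhaustive.)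
-- If w = u ∷ʳ s then verts u = (v₀,…,v_{m-1}); if moreover u = u' ∷ʳ s'
-- then endpoint u' = v_{m-2}.
IsSawVertex : List Step → Set
IsSawVertex w =
  ∀ u s → w ≡ u ∷ʳ s →
    Unique (verts u) × (∀ u' s' → u ≡ u' ∷ʳ s' → endpoint w ≢ endpoint u')

IsLeaf : List Step → Set
IsLeaf w = IsSawVertex w × (∃[ u ] ∃[ s ] (w ≡ u ∷ʳ s × endpoint w ∈ verts u))

-- An assignment of labels to the leaves: true = occupied, false = unoccupied.
Labelling : Set
Labelling = (w : List Step) → IsLeaf w → Bool

OccupiedLeaf : Labelling → List Step → Set
OccupiedLeaf σ c = Σ[ l ∈ IsLeaf c ] σ c l ≡ true

UnoccupiedLeaf : Labelling → List Step → Set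
UnoccupiedLeaf σ c = Σ[ l ∈ IsLeaf c ] σ c l ≡ false

-- Vertices of T_saw^σ(ℤ²): vertices of T_saw that are not unoccupied leaves
-- and do not lie in the subtree rooted at the parent of an occupied leaf,
-- i.e. no prefix p of w (including w itself) has an occupied leaf child.
IsSawΣVertex : Labelling → List Step → Set
IsSawΣVertex σ w =
  IsSawVertex w
  × ¬ UnoccupiedLeaf σ w
  × (∀ p r → p ++ r ≡ w → ∀ s → ¬ OccupiedLeaf σ (p ∷ʳ s))

data State : Set where
  O sN sW sE NN NW NE WW EE WN EN : State

-- last letter of a state name (= step just taken); O never occurs as a child
lastStep : State → Step
lastStep O  = N
lastStep sN = N
lastStep sW = W
lastStep sE = E
lastStep NN = N
lastStep NW = W
lastStep NE = E
lastStep WW = W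
lastStep EE = E
lastStep WN = N
lastStep EN = N

children : State → List State
children O  = sN ∷ sE ∷ sW ∷ []
children sN = NN ∷ NE ∷ NW ∷ []
children sW = WN ∷ WW ∷ []
children sE = EN ∷ EE ∷ []
children NN = NN ∷ NE ∷ NW ∷ []
children NW = WN ∷ WW ∷ []
children NE = EN ∷ EE ∷ []
children WW = WN ∷ WW ∷ []
children EE = EN ∷ EE ∷ []
children WN = NW ∷ NN ∷ []
children EN = NE ∷ NN ∷ []

-- Generated st w : the walk continuing with steps w from a vertex in state st
-- is in the tree generated from st.
data Generated : State → List Step → Set where
  here : ∀ {st} → Generated st []
  step : ∀ {st st' w} → st' ∈ children st →
         Generated st' w → Generated st (lastStep st' ∷ w)

IsDGVertex : List Step → Set
IsDGVertex w = Generated O w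

-- Walks of T_{D_G} use only the steps N, E, W and never reverse a step, so
-- each row is visited along one horizontal run and the walk is self-avoiding.
-- The forbidden patterns ENW and WNE ensure more: the only earlier vertex
-- adjacent to the current endpoint is the previous one.  To see this, one
-- tracks, depending on the current state, a region around the endpoint that
-- contains the whole walk: nothing lies above the endpoint's row, and the
-- vertices in that row and the row just below lie on one side of the endpoint.
-- Hence no one-step extension of a walk of T_{D_G} (or of any of its
-- prefixes) closes a cycle other than by backtracking, i.e. no such walk has
-- a leaf child in T_saw, and neither labelled leaves nor pruned subtrees
-- reach T_{D_G}.
module Submission where

open import Defs
open import Data.Empty using (⊥-elim)
open import Data.Integer using (ℤ; _+_; 1ℤ; -1ℤ; _<_; _≤_; _>_; _≥_)
open import Data.Integer.Properties
  using (<-irrefl; <-asym; <⇒≢; <⇒≤; <⇒≱; ≤-refl; ≤-reflexive; ≤-trans; <-trans;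
         ≤-<-trans; <-≤-trans; +-comm; +-assoc; +-identityʳ; suc[i]≤j⇒i<j; i≤pred[j]⇒i<j)
open import Data.List using (List; []; _∷_; _++_; _∷ʳ_)
open import Data.List.Properties using (∷ʳ-injective; ++-assoc; ++-identityʳ)
open import Data.List.Membership.Propositional using (_∈_; _∉_)
open import Data.List.Membership.Propositional.Properties using (∈-++⁺ˡ)
open import Data.List.Relation.Unary.Any using (here; there)
open import Data.List.Relation.Unary.All as All using (All; []; _∷_)
import Data.List.Relation.Unary.All.Properties as All
open import Data.List.Relation.Unary.AllPairs using ([]; _∷_)
open import Data.List.Relation.Unary.Unique.Propositional using (Unique)
import Data.List.Relation.Unary.Unique.Propositional.Properties as Unique
open import Data.Product using (∃; ∃-syntax; _×_; _,_; proj₁; proj₂)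
open import Function using (id)
open import Level using (0ℓ)
open import Relation.Binary using (Rel; _⇒_)
open import Relation.Binary.PropositionalEquality
open import Relation.Nullary using (¬_)

i<i+1 : ∀ i → i < i + 1ℤ
i<i+1 i = suc[i]≤j⇒i<j (≤-reflexive (+-comm 1ℤ i))

i-1<i : ∀ i → i + -1ℤ < i
i-1<i i = i≤pred[j]⇒i<j (≤-reflexive (+-comm i -1ℤ))

i<i+1+1 : ∀ i → i < i + 1ℤ + 1ℤ
i<i+1+1 i = <-trans (i<i+1 i) (i<i+1 (i + 1ℤ))

i+1-1≡i : ∀ i → i + 1ℤ + -1ℤ ≡ i
i+1-1≡i i = trans (+-assoc i 1ℤ -1ℤ) (+-identityʳ i)

i-1+1≡i : ∀ i → i + -1ℤ + 1ℤ ≡ i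
i-1+1≡i i = trans (+-assoc i -1ℤ 1ℤ) (+-identityʳ i)

reverse : Step → Step
reverse N = S
reverse S = N
reverse E = W
reverse W = E

move-reverse : ∀ q s → move (move q s) (reverse s) ≡ q
move-reverse (x , y) N = cong (x ,_) (i+1-1≡i y)
move-reverse (x , y) S = cong (x ,_) (i-1+1≡i y)
move-reverse (x , y) E = cong (_, y) (i+1-1≡i x)
move-reverse (x , y) W = cong (_, y) (i-1+1≡i x)

endpointFrom-∷ʳ : ∀ p u s → endpointFrom p (u ∷ʳ s) ≡ move (endpointFrom p u) s
endpointFrom-∷ʳ p []      s = refl
endpointFrom-∷ʳ p (t ∷ u) s = endpointFrom-∷ʳ (move p t) u s

vertsFrom-∷ʳ : ∀ p u s → vertsFrom p (u ∷ʳ s) ≡ vertsFrom p u ∷ʳ endpointFrom p (u ∷ʳ s)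
vertsFrom-∷ʳ p []      s = refl
vertsFrom-∷ʳ p (t ∷ u) s = cong (p ∷_) (vertsFrom-∷ʳ (move p t) u s)

endpointFrom∈vertsFrom : ∀ p u → endpointFrom p u ∈ vertsFrom p u
endpointFrom∈vertsFrom p []      = here refl
endpointFrom∈vertsFrom p (t ∷ u) = there (endpointFrom∈vertsFrom (move p t) u)

Unique-∷ʳ⁻ : ∀ {A : Set} {xs : List A} {x} → Unique (xs ∷ʳ x) → Unique xs × x ∉ xs
Unique-∷ʳ⁻ {xs = []}     _           = [] , λ ()
Unique-∷ʳ⁻ {xs = y ∷ xs} (y∉ ∷ uniq) with All.∷ʳ⁻ y∉ | Unique-∷ʳ⁻ uniq
... | y∉xs , y≢x | uniq-xs , x∉xs = y∉xs ∷ uniq-xs , λ where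
  (here refl) → y≢x refl
  (there x∈xs) → x∉xs x∈xs

self-avoiding-∷ʳ : ∀ u s → Unique (verts (u ∷ʳ s)) →
                   Unique (verts u) × endpoint (u ∷ʳ s) ∉ verts u
self-avoiding-∷ʳ u s uniq = Unique-∷ʳ⁻ (subst Unique (vertsFrom-∷ʳ origin u s) uniq)

self-avoiding⇒IsSawVertex : ∀ w → Unique (verts w) → IsSawVertex w
self-avoiding⇒IsSawVertex .(u ∷ʳ s) uniq u s refl = proj₁ split , no-return
  where
  split : Unique (verts u) × endpoint (u ∷ʳ s) ∉ verts u
  split = self-avoiding-∷ʳ u s uniq

  no-return : ∀ u' s' → u ≡ u' ∷ʳ s' → endpoint (u ∷ʳ s) ≢ endpoint u'
  no-return u' s' refl e = proj₂ split
    (subst (_∈ verts u) (sym e)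
      (subst (endpoint u' ∈_) (sym (vertsFrom-∷ʳ origin u' s'))
        (∈-++⁺ˡ (endpointFrom∈vertsFrom origin u'))))

self-avoiding⇒¬IsLeaf : ∀ {w} → Unique (verts w) → ¬ IsLeaf w
self-avoiding⇒¬IsLeaf uniq (_ , u , s , refl , returns) =
  proj₂ (self-avoiding-∷ʳ u s uniq) returns

-- Where an earlier vertex v may lie relative to the endpoint q: c and d
-- constrain its abscissa in the row just below q and in the row of q; rows
-- further down are unconstrained, as no step goes south.
data Below (c d : Rel ℤ 0ℓ) : Pt → Pt → Set where
  lower    : ∀ {X Y x y} → y + 1ℤ < Y → Below c d (X , Y) (x , y)
  previous : ∀ {X Y x y} → y + 1ℤ ≡ Y → c x X → Below c d (X , Y) (x , y)
  current  : ∀ {X Y x y} → y ≡ Y → d x X → Below c d (X , Y) (x , y)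

Below-refl : ∀ {c d} → (∀ {x} → d x x) → ∀ q → Below c d q q
Below-refl d-refl q = current refl d-refl

Below-north : ∀ {c d q v} → Below c d q v → Below d _≡_ (move q N) v
Below-north {q = _ , Y} (lower y+1<Y) = lower (<-trans y+1<Y (i<i+1 Y))
Below-north {q = _ , Y} (previous y+1≡Y _) = lower (subst (_< Y + 1ℤ) (sym y+1≡Y) (i<i+1 Y))
Below-north (current y≡Y dxX) = previous (cong (_+ 1ℤ) y≡Y) dxX

Below-east : ∀ {c d q v} → c ⇒ _≤_ → d ⇒ _≤_ → Below c d q v → Below _<_ _≤_ (move q E) v
Below-east _ _ (lower y+1<Y) = lower y+1<Y
Below-east {q = X , _} c⇒≤ _ (previous e cxX) = previous e (≤-<-trans (c⇒≤ cxX) (i<i+1 X))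
Below-east {q = X , _} _ d⇒≤ (current e dxX) = current e (≤-trans (d⇒≤ dxX) (<⇒≤ (i<i+1 X)))

Below-west : ∀ {c d q v} → c ⇒ _≥_ → d ⇒ _≥_ → Below c d q v → Below _>_ _≥_ (move q W) v
Below-west _ _ (lower y+1<Y) = lower y+1<Y
Below-west {q = X , _} c⇒≥ _ (previous e cxX) = previous e (<-≤-trans (i-1<i X) (c⇒≥ cxX))
Below-west {q = X , _} _ d⇒≥ (current e dxX) = current e (≤-trans (<⇒≤ (i-1<i X)) (d⇒≥ dxX))

Below-north-neighbour : ∀ {c d} q → ¬ Below c d q (move q N)
Below-north-neighbour (_ , Y) (lower higher) = <-asym higher (i<i+1+1 Y)
Below-north-neighbour (_ , Y) (previous e _) = <⇒≢ (i<i+1+1 Y) (sym e)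
Below-north-neighbour (_ , Y) (current e _) = <⇒≢ (i<i+1 Y) (sym e)

Below-east-neighbour : ∀ {c d} q → Below c d q (move q E) → d (proj₁ q + 1ℤ) (proj₁ q)
Below-east-neighbour (_ , Y) (lower higher) = ⊥-elim (<-asym higher (i<i+1 Y))
Below-east-neighbour (_ , Y) (previous e _) = ⊥-elim (<⇒≢ (i<i+1 Y) (sym e))
Below-east-neighbour _ (current _ dxX) = dxX

Below-west-neighbour : ∀ {c d} q → Below c d q (move q W) → d (proj₁ q + -1ℤ) (proj₁ q)
Below-west-neighbour (_ , Y) (lower higher) = ⊥-elim (<-asym higher (i<i+1 Y))
Below-west-neighbour (_ , Y) (previous e _) = ⊥-elim (<⇒≢ (i<i+1 Y) (sym e))
Below-west-neighbour _ (current _ dxX) = dxX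

Below-south-neighbour : ∀ {c d} q → Below c d q (move q S) → c (proj₁ q) (proj₁ q)
Below-south-neighbour (_ , Y) (lower y+1<Y) = ⊥-elim (<-irrefl (i-1+1≡i Y) y+1<Y)
Below-south-neighbour _ (previous _ cXX) = cXX
Below-south-neighbour (_ , Y) (current e _) = ⊥-elim (<⇒≢ (i-1<i Y) e)

backtrack-north : ∀ {c} q s → Below c _≡_ q (move q s) → s ≡ S
backtrack-north q N b = ⊥-elim (Below-north-neighbour q b)
backtrack-north q E b = ⊥-elim (<⇒≢ (i<i+1 (proj₁ q)) (sym (Below-east-neighbour q b)))
backtrack-north q W b = ⊥-elim (<⇒≢ (i-1<i (proj₁ q)) (Below-west-neighbour q b))
backtrack-north q S b = refl

backtrack-east : ∀ q s → Below _<_ _≤_ q (move q s) → s ≡ W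
backtrack-east q N b = ⊥-elim (Below-north-neighbour q b)
backtrack-east q E b = ⊥-elim (<⇒≱ (i<i+1 (proj₁ q)) (Below-east-neighbour q b))
backtrack-east q W b = refl
backtrack-east q S b = ⊥-elim (<-irrefl refl (Below-south-neighbour q b))

backtrack-west : ∀ q s → Below _>_ _≥_ q (move q s) → s ≡ E
backtrack-west q N b = ⊥-elim (Below-north-neighbour q b)
backtrack-west q E b = refl
backtrack-west q W b = ⊥-elim (<⇒≱ (i-1<i (proj₁ q)) (Below-west-neighbour q b))
backtrack-west q S b = ⊥-elim (<-irrefl refl (Below-south-neighbour q b))

Region : State → Pt → Pt → Set
Region O  = Below _≡_ _≡_
Region sN = Below _≡_ _≡_
Region NN = Below _≡_ _≡_
Region EN = Below _≤_ _≡_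
Region WN = Below _≥_ _≡_
Region sE = Below _<_ _≤_
Region NE = Below _<_ _≤_
Region EE = Below _<_ _≤_
Region sW = Below _>_ _≥_
Region NW = Below _>_ _≥_
Region WW = Below _>_ _≥_

Region-refl : ∀ st q → Region st q q
Region-refl O  = Below-refl refl
Region-refl sN = Below-refl refl
Region-refl NN = Below-refl refl
Region-refl EN = Below-refl refl
Region-refl WN = Below-refl refl
Region-refl sE = Below-refl ≤-refl
Region-refl NE = Below-refl ≤-refl
Region-refl EE = Below-refl ≤-refl
Region-refl sW = Below-refl ≤-refl
Region-refl NW = Below-refl ≤-refl
Region-refl WW = Below-refl ≤-refl

-- Since lastStep O = N, the root is treated as a north state; that its
-- south neighbour is not the origin is checked in adjacent-earlier-vertex.
backtrack : ∀ st q s → Region st q (move q s) → s ≡ reverse (lastStep st)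
backtrack O  = backtrack-north
backtrack sN = backtrack-north
backtrack NN = backtrack-north
backtrack EN = backtrack-north
backtrack WN = backtrack-north
backtrack sE = backtrack-east
backtrack NE = backtrack-east
backtrack EE = backtrack-east
backtrack sW = backtrack-west
backtrack NW = backtrack-west
backtrack WW = backtrack-west

Transition : State → State → Set
Transition st st' = ∀ {q v} → Region st q v → Region st' (move q (lastStep st')) v

≡⇒≥ : _≡_ ⇒ _≥_
≡⇒≥ e = ≤-reflexive (sym e)

transitions : ∀ st → All (Transition st) (children st)
transitions O  = Below-north ∷ Below-east ≤-reflexive ≤-reflexive ∷ Below-west ≡⇒≥ ≡⇒≥ ∷ []
transitions sN = Below-north ∷ Below-east ≤-reflexive ≤-reflexive ∷ Below-west ≡⇒≥ ≡⇒≥ ∷ []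
transitions NN = Below-north ∷ Below-east ≤-reflexive ≤-reflexive ∷ Below-west ≡⇒≥ ≡⇒≥ ∷ []
transitions EN = Below-east id ≤-reflexive ∷ Below-north ∷ []
transitions WN = Below-west id ≡⇒≥ ∷ Below-north ∷ []
transitions sE = Below-north ∷ Below-east <⇒≤ id ∷ []
transitions NE = Below-north ∷ Below-east <⇒≤ id ∷ []
transitions EE = Below-north ∷ Below-east <⇒≤ id ∷ []
transitions sW = Below-north ∷ Below-west <⇒≤ id ∷ []
transitions NW = Below-north ∷ Below-west <⇒≤ id ∷ []
transitions WW = Below-north ∷ Below-west <⇒≤ id ∷ []

children-never-reverse : ∀ st → All (λ st' → lastStep st' ≢ reverse (lastStep st)) (children st)
children-never-reverse O  = (λ ()) ∷ (λ ()) ∷ (λ ()) ∷ []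
children-never-reverse sN = (λ ()) ∷ (λ ()) ∷ (λ ()) ∷ []
children-never-reverse NN = (λ ()) ∷ (λ ()) ∷ (λ ()) ∷ []
children-never-reverse EN = (λ ()) ∷ (λ ()) ∷ []
children-never-reverse WN = (λ ()) ∷ (λ ()) ∷ []
children-never-reverse sE = (λ ()) ∷ (λ ()) ∷ []
children-never-reverse NE = (λ ()) ∷ (λ ()) ∷ []
children-never-reverse EE = (λ ()) ∷ (λ ()) ∷ []
children-never-reverse sW = (λ ()) ∷ (λ ()) ∷ []
children-never-reverse NW = (λ ()) ∷ (λ ()) ∷ []
children-never-reverse WW = (λ ()) ∷ (λ ()) ∷ []

data Reaches : List Step → State → Set where
  root   : Reaches [] O
  extend : ∀ {u st st'} → Reaches u st → st' ∈ children st → Reaches (u ∷ʳ lastStep st') st'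

Reaches-++ : ∀ {u st w} → Reaches u st → Generated st w → ∃ (Reaches (u ++ w))
Reaches-++ {u} r here = _ , subst (λ p → Reaches p _) (sym (++-identityʳ u)) r
Reaches-++ {u} r (step {st' = st'} {w} child g) =
  subst (λ p → ∃ (Reaches p)) (++-assoc u (lastStep st' ∷ []) w) (Reaches-++ (extend r child) g)

IsDGVertex⇒Reaches : ∀ {w} → IsDGVertex w → ∃ (Reaches w)
IsDGVertex⇒Reaches = Reaches-++ root

Generated-prefix : ∀ {st} p {r} → Generated st (p ++ r) → Generated st p
Generated-prefix []      _              = here
Generated-prefix (_ ∷ p) (step child g) = step child (Generated-prefix p g)

Reaches⇒Region : ∀ {p st} → Reaches p st → All (Region st (endpoint p)) (verts p)
Reaches⇒Region root = Region-refl O origin ∷ []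
Reaches⇒Region (extend {u} {st} {st'} r child)
  rewrite vertsFrom-∷ʳ origin u (lastStep st') | endpointFrom-∷ʳ origin u (lastStep st') =
  All.∷ʳ⁺ (All.map (All.lookup (transitions st) child) (Reaches⇒Region r)) (Region-refl st' _)

Reaches⇒self-avoiding : ∀ {p st} → Reaches p st → Unique (verts p)
Reaches⇒self-avoiding root = [] ∷ []
Reaches⇒self-avoiding (extend {u} {st} {st'} r child)
  rewrite vertsFrom-∷ʳ origin u (lastStep st') | endpointFrom-∷ʳ origin u (lastStep st') =
  Unique.++⁺ (Reaches⇒self-avoiding r) ([] ∷ []) fresh
  where
  fresh : ∀ {v} → ¬ (v ∈ verts u × v ∈ move (endpoint u) (lastStep st') ∷ [])
  fresh (old , here refl) =
    All.lookup (children-never-reverse st) child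
      (backtrack st _ _ (All.lookup (Reaches⇒Region r) old))

adjacent-earlier-vertex : ∀ {p st} → Reaches p st → ∀ s → endpoint (p ∷ʳ s) ∈ verts p →
  ∃[ u ] ∃[ t ] (p ≡ u ∷ʳ t × endpoint (p ∷ʳ s) ≡ endpoint u)
adjacent-earlier-vertex {p} {st} r s adjacent
  with backtrack st _ s
         (subst (Region st (endpoint p)) (endpointFrom-∷ʳ origin p s)
           (All.lookup (Reaches⇒Region r) adjacent))
adjacent-earlier-vertex root .S (here ()) | refl
adjacent-earlier-vertex (extend {u} {st' = st'} _ _) _ _ | refl = u , t , refl , (begin
    endpoint (u ∷ʳ t ∷ʳ reverse t)         ≡⟨ endpointFrom-∷ʳ origin (u ∷ʳ t) (reverse t) ⟩
    move (endpoint (u ∷ʳ t)) (reverse t)   ≡⟨ cong (λ q → move q (reverse t)) (endpointFrom-∷ʳ origin u t) ⟩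
    move (move (endpoint u) t) (reverse t) ≡⟨ move-reverse (endpoint u) t ⟩
    endpoint u                             ∎)
  where
  open ≡-Reasoning
  t : Step
  t = lastStep st'

IsDGVertex⇒¬IsLeaf-∷ʳ : ∀ {p} → IsDGVertex p → ∀ s → ¬ IsLeaf (p ∷ʳ s)
IsDGVertex⇒¬IsLeaf-∷ʳ {p} g s (saw , u , s' , eq , returns)
  with refl , refl ← ∷ʳ-injective p u eq
  with u' , t , p≡u'∷ʳt , e ← adjacent-earlier-vertex (proj₂ (IsDGVertex⇒Reaches g)) s returns
  = proj₂ (saw p s refl) u' t p≡u'∷ʳt e

theorem3 : (σ : Labelling) (w : List Step) → IsDGVertex w → IsSawΣVertex σ w
theorem3 σ w g =
  self-avoiding⇒IsSawVertex w avoiding ,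
  (λ (leaf , _) → self-avoiding⇒¬IsLeaf avoiding leaf) ,
  λ p r p++r≡w s (leaf , _) →
    IsDGVertex⇒¬IsLeaf-∷ʳ (Generated-prefix p (subst IsDGVertex (sym p++r≡w) g)) s leaf
  where
  avoiding : Unique (verts w)
  avoiding = Reaches⇒self-avoiding (proj₂ (IsDGVertex⇒Reaches g))
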